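{- Let $(h,\ast,1)$ be a connected associative presheaf and $o\in h[I]$. Suppose $(x_1,\dots,x_k)$ and $(y_1,\dots,y_s)$ are two factorizations of $o$ into irreducible objects, with $x_i\in h[A_i]$ and $y_i\in h[B_i]$, so that $(A_1,\dots,A_k)$ and $(B_1,\dots,B_s)$ are set compositions of $I$. Then the underlying set partitions coincide: $\{A_1,\dots,A_k\}=\{B_1,\dots,B_s\}$. In particular the number of irreducible factors and the multiset of irreducible factors of $o$ do not depend on the factorization into irreducibles.
   Context: A combinatorial presheaf $h$ is a contravariant functor from finite sets with injections to finite sets; $h[I]$ are objects on $I$, $a|_J$ restriction to $J\subseteq I$. An associative presheaf $(h,\ast,1)$ has maps $h[I]\times h[J]\to h[I\sqcup J]$, $(a,b)\mapsto a\ast b$, for disjoint $I,J$, natural in relabelings, with $(a\ast b)|_{A\sqcup B}=a|_A\ast b|_B$ for $A\subseteq I,B\subseteq J$, associative, with unit $1\in h[\emptyset]$ ($a\ast1=1\ast a=a$). It is connected if $|h[\emptyset]|=1$. An object $t\ne1$ is irreducible if whenever $t=a\ast b$ then $a=1$ or $b=1$. A factorization of $o\in h[I]$ is a word $(x_1,\dots,x_k)$ of objects on pairwise disjoint sets $I_1,\dots,I_k$ with $x_1\ast\cdots\ast x_k=o$; it is into irreducibles if each $x_i$ is irreducible. A set composition of $I$ is a list of pairwise disjoint nonempty sets with union $I$; its underlying set partition forgets the order. -}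

module Defs where

open import Level using (Level; suc; _⊔_)
open import Data.Nat using (ℕ; zero; _+_)
open import Data.Fin using (Fin; zero; suc; _↑ˡ_; _↑ʳ_)
open import Data.List using (List; []; _∷_; length)
open import Data.Product using (Σ; ∃; ∃-syntax; _×_; _,_; proj₁; proj₂)
open import Relation.Nullary using (¬_)
open import Data.Sum using (_⊎_)
open import Relation.Binary.PropositionalEquality using (_≡_)
open import Function.Bundles using (_↣_; _↔_; Injection; Inverse; _⇔_)
open import Function.Construct.Identity using (↣-id)
open import Function.Construct.Composition using (_↣-∘_)
open import Function.Properties.Inverse using (↔⇒↣)

-- Combinatorial presheaves, on the skeleton of finite sets with
-- injections: the finite set with n elements is  Fin n , and
-- H n = h[Fin n].
-- Restriction a|_J to J ⊆ I is the action of an inclusion; relabeling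
-- is the action of a bijection.

record Presheaf : Set₁ where
  field
    H      : ℕ → Set
    act    : ∀ {m n} → (Fin m ↣ Fin n) → H n → H m
    act-ext  : ∀ {m n} (f g : Fin m ↣ Fin n) →
               (∀ i → Injection.to f i ≡ Injection.to g i) →
               ∀ x → act f x ≡ act g x
    act-id   : ∀ {n} (x : H n) → act (↣-id (Fin n)) x ≡ x
    act-comp : ∀ {l m n} (f : Fin m ↣ Fin n) (g : Fin l ↣ Fin m) (x : H n) →
               act (f ↣-∘ g) x ≡ act g (act f x)
    finite   : ∀ n → ∃[ k ] (H n ↔ Fin k)

module _ (P : Presheaf) where
  open Presheaf P

  Obj : Set
  Obj = Σ ℕ H

-- Associative presheaves.  The disjoint union of  Fin m  and  Fin n  is
-- Fin (m + n)  (first summand via _↑ˡ_, second via _↑ʳ_).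

record AssocPresheaf : Set₁ where
  field
    presheaf : Presheaf
  open Presheaf presheaf public
  field
    _∗_ : ∀ {m n} → H m → H n → H (m + n)
    one : H 0
    -- naturality in relabelings together with compatibility with
    -- restriction: for injections f, g the action of f ⊔ g
    -- (characterised pointwise by h) commutes with ∗.
    ∗-natural : ∀ {m' n' m n} (f : Fin m' ↣ Fin m) (g : Fin n' ↣ Fin n)
                (h : Fin (m' + n') ↣ Fin (m + n)) →
                (∀ i → Injection.to h (i ↑ˡ n') ≡ (Injection.to f i ↑ˡ n)) →
                (∀ j → Injection.to h (m' ↑ʳ j) ≡ (m ↑ʳ Injection.to g j)) →
                ∀ (a : H m) (b : H n) →
                act h (a ∗ b) ≡ (act f a ∗ act g b)
    -- associativity and unit, as equalities of objects (Σ ℕ H),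
    -- i.e. up to the canonical identification of the underlying sets
    ∗-assoc : ∀ {l m n} (a : H l) (b : H m) (c : H n) →
              _≡_ {A = Σ ℕ H} (_ , ((a ∗ b) ∗ c)) (_ , (a ∗ (b ∗ c)))
    ∗-unitʳ : ∀ {m} (a : H m) → _≡_ {A = Σ ℕ H} (_ , (a ∗ one)) (_ , a)
    ∗-unitˡ : ∀ {m} (a : H m) → _≡_ {A = Σ ℕ H} (_ , (one ∗ a)) (_ , a)

module _ (P : AssocPresheaf) where
  open AssocPresheaf P

  unitObj : Σ ℕ H
  unitObj = (0 , one)

  Connected : Set
  Connected = ∀ (x : H 0) → x ≡ one

  -- t = a ∗ b : with a ∈ h[I], b ∈ h[J], I ⊔ J the underlying set of t;
  -- in the skeleton, I ⊔ J is identified with the support of t by a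
  -- bijection σ.
  IsProduct : ∀ {m p q} → H m → H p → H q → Set
  IsProduct {m} {p} {q} t a b =
    Σ (Fin (p + q) ↔ Fin m) λ σ → act (↔⇒↣ σ) t ≡ (a ∗ b)

  Irreducible : ∀ {m} → H m → Set
  Irreducible {m} t =
    ¬ (_≡_ {A = Σ ℕ H} (m , t) unitObj) ×
    (∀ {p q} (a : H p) (b : H q) → IsProduct t a b →
       (_≡_ {A = Σ ℕ H} (p , a) unitObj) ⊎ (_≡_ {A = Σ ℕ H} (q , b) unitObj))

  total : List (Σ ℕ H) → ℕ
  total []             = 0
  total ((m , _) ∷ xs) = m + total xs

  prod : (xs : List (Σ ℕ H)) → H (total xs)
  prod []             = one
  prod ((_ , x) ∷ xs) = x ∗ prod xs

  size : (xs : List (Σ ℕ H)) → Fin (length xs) → ℕ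
  size ((m , _) ∷ xs) zero    = m
  size (_ ∷ xs)       (suc i) = size xs i

  factor : (xs : List (Σ ℕ H)) → (i : Fin (length xs)) → H (size xs i)
  factor ((_ , x) ∷ xs) zero    = x
  factor (_ ∷ xs)       (suc i) = factor xs i

  slot : (xs : List (Σ ℕ H)) → (i : Fin (length xs)) →
         Fin (size xs i) → Fin (total xs)
  slot ((m , _) ∷ xs) zero    p = p ↑ˡ total xs
  slot ((m , _) ∷ xs) (suc i) p = m ↑ʳ slot xs i p

  -- A factorization of o ∈ h[Fin n]: a word of objects x₁,…,xₖ on
  -- pairwise disjoint sets A₁,…,Aₖ with A₁ ⊔ ⋯ ⊔ Aₖ = Fin n (the
  -- identification is the bijection σ) and x₁ ∗ ⋯ ∗ xₖ = o.
  record Factorization {n : ℕ} (o : H n) : Set where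
    field
      factors : List (Σ ℕ H)
      σ       : Fin (total factors) ↔ Fin n
      is-prod : act (↔⇒↣ σ) o ≡ prod factors

    len : ℕ
    len = length factors

    emb : (i : Fin len) → Fin (size factors i) → Fin n
    emb i p = Inverse.to σ (slot factors i p)

    InBlock : Fin len → Fin n → Set
    InBlock i e = ∃[ p ] emb i p ≡ e

    x : (i : Fin len) → H (size factors i)
    x i = factor factors i

  open Factorization public

  IntoIrreducibles : ∀ {n} {o : H n} → Factorization o → Set
  IntoIrreducibles F = ∀ i → Irreducible (x F i)

  SameSubset : ∀ {n} → (Fin n → Set) → (Fin n → Set) → Set
  SameSubset {n} A B = ∀ (e : Fin n) → (A e ⇔ B e)

  SamePartition : ∀ {n} {o : H n} → Factorization o → Factorization o → Set
  SamePartition F G =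
    (∀ i → ∃[ j ] SameSubset (InBlock F i) (InBlock G j)) ×
    (∀ j → ∃[ i ] SameSubset (InBlock F i) (InBlock G j))

  SameFactor : ∀ {n} {o : H n} (F G : Factorization o) →
               Fin (len F) → Fin (len G) → Set
  SameFactor F G i j =
    Σ (Fin (size (factors F) i) ↔ Fin (size (factors G) j)) λ ρ →
      (∀ p → emb G j (Inverse.to ρ p) ≡ emb F i p) ×
      act (↔⇒↣ ρ) (x G j) ≡ x F i

  SameFactorMultiset : ∀ {n} {o : H n} → Factorization o → Factorization o → Set
  SameFactorMultiset F G =
    Σ (Fin (len F) ↔ Fin (len G)) λ π → ∀ i → SameFactor F G i (Inverse.to π i)

-- The restriction of a product a ∗ b to a set K is, by the compatibility of
-- ∗ with restriction, the product of the restrictions of a and b to the parts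
-- of K in their supports.  If that restriction is irreducible, one of the two
-- parts is empty, so by induction an irreducible restriction of x₁ ∗ ⋯ ∗ xₖ is
-- supported inside a single block.  The restriction of o to a block of one
-- factorization is its (irreducible) factor, hence every block of one
-- factorization lies inside a block of the other.  Irreducible objects have
-- nonempty support by connectedness, and blocks are pairwise disjoint, so the
-- two inclusion maps between the blocks are mutually inverse: the blocks
-- coincide, and so do the factors, being restrictions of o to the same sets.
module Submission where

open import Defs
open import Data.Nat using (ℕ; zero; suc; _+_)
open import Data.Nat.Properties using (+-identityʳ; ≡-irrelevant)
open import Data.Fin using (Fin; zero; suc; _↑ˡ_; _↑ʳ_; splitAt; join; cast)
open import Data.Fin.Properties
  using (splitAt-↑ˡ; splitAt-↑ʳ; join-splitAt; ↑ˡ-injective; ↑ʳ-injective; cast-is-id; cast-involutive; +↔⊎)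
open import Data.Fin.Permutation using (↔⇒≡)
open import Data.List using (List; []; _∷_)
open import Data.Product using (Σ; ∃-syntax; _×_; _,_; proj₁; proj₂; map₂)
open import Data.Product.Properties using (,-injectiveˡ; ,-injectiveʳ-UIP)
open import Data.Sum using (_⊎_; inj₁; inj₂; map₁)
open import Data.Sum.Properties using (inj₁-injective; inj₂-injective)
open import Data.Sum.Algebra using (⊎-comm)
open import Data.Empty using (⊥-elim)
open import Function using (_∘_)
open import Relation.Nullary using (¬_)
open import Relation.Binary.PropositionalEquality
open import Function.Bundles using (Injection; Inverse; _↣_; _↔_; mk↣; mk↔ₛ′; mk⇔)
open import Function.Construct.Composition using (_↣-∘_; _↔-∘_)
open import Function.Construct.Identity using (↣-id)
open import Function.Construct.Symmetry using (↔-sym)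
open import Function.Properties.Inverse using (↔⇒↣)

open Injection using (to; injective)

↑ˡ≢↑ʳ : ∀ {m n} (i : Fin m) (j : Fin n) → i ↑ˡ n ≢ m ↑ʳ j
↑ˡ≢↑ʳ {m} {n} i j eq
  with trans (sym (splitAt-↑ˡ m i n)) (trans (cong (splitAt m) eq) (splitAt-↑ʳ m n j))
... | ()

Fin-≡0 : ∀ {m} → m ≡ 0 → ¬ Fin m
Fin-≡0 refl ()

cast-↑ˡ0 : ∀ {m} (i : Fin m) → cast (+-identityʳ m) (i ↑ˡ 0) ≡ i
cast-↑ˡ0 {suc m} zero    = refl
cast-↑ˡ0 {suc m} (suc i) = cong suc (cast-↑ˡ0 i)

cast-↣ : ∀ {k k′} → k ≡ k′ → Fin k ↣ Fin k′
cast-↣ eq = mk↣ λ {i} {j} castᵢ≡castⱼ →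
  trans (sym (cast-involutive (sym eq) eq i))
        (trans (cong (cast (sym eq)) castᵢ≡castⱼ) (cast-involutive (sym eq) eq j))

↑ˡ-↣ : ∀ m n → Fin m ↣ Fin (m + n)
↑ˡ-↣ m n = mk↣ (↑ˡ-injective n _ _)

↑ʳ-↣ : ∀ m n → Fin n ↣ Fin (m + n)
↑ʳ-↣ m n = mk↣ (↑ʳ-injective m _ _)

Fin0-↣ : ∀ {n} → Fin 0 ↣ Fin n
Fin0-↣ = mk↣ {to = λ ()} λ { {()} }

suc-⊎ˡ-↔ : ∀ {m₁ m₂ m} → (Fin m₁ ⊎ Fin m₂) ↔ Fin m → (Fin (suc m₁) ⊎ Fin m₂) ↔ Fin (suc m)
suc-⊎ˡ-↔ {m₁} {m₂} {m} μ = mk↔ₛ′ to′ from′ to′∘from′ from′∘to′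
  where
  open Inverse μ using (from; strictlyInverseˡ; strictlyInverseʳ) renaming (to to μ-to)
  to′ : Fin (suc m₁) ⊎ Fin m₂ → Fin (suc m)
  to′ (inj₁ zero)    = zero
  to′ (inj₁ (suc i)) = suc (μ-to (inj₁ i))
  to′ (inj₂ j)       = suc (μ-to (inj₂ j))
  from′ : Fin (suc m) → Fin (suc m₁) ⊎ Fin m₂
  from′ zero    = inj₁ zero
  from′ (suc k) = map₁ suc (from k)
  to′∘map₁suc : ∀ s → to′ (map₁ suc s) ≡ suc (μ-to s)
  to′∘map₁suc (inj₁ i) = refl
  to′∘map₁suc (inj₂ j) = refl
  to′∘from′ : ∀ k → to′ (from′ k) ≡ k
  to′∘from′ zero    = refl
  to′∘from′ (suc k) = trans (to′∘map₁suc (from k)) (cong suc (strictlyInverseˡ k))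
  from′∘to′ : ∀ s → from′ (to′ s) ≡ s
  from′∘to′ (inj₁ zero)    = refl
  from′∘to′ (inj₁ (suc i)) = cong (map₁ suc) (strictlyInverseʳ (inj₁ i))
  from′∘to′ (inj₂ j)       = cong (map₁ suc) (strictlyInverseʳ (inj₂ j))

suc-⊎ʳ-↔ : ∀ {m₁ m₂ m} → (Fin m₁ ⊎ Fin m₂) ↔ Fin m → (Fin m₁ ⊎ Fin (suc m₂)) ↔ Fin (suc m)
suc-⊎ʳ-↔ μ = suc-⊎ˡ-↔ (μ ↔-∘ ⊎-comm _ _) ↔-∘ ⊎-comm _ _

record SumSplit {A B : Set} {m : ℕ} (f : Fin m → A ⊎ B) : Set where
  field
    m₁ m₂ : ℕ
    μ     : (Fin m₁ ⊎ Fin m₂) ↔ Fin m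
    f₁    : Fin m₁ → A
    f₂    : Fin m₂ → B
    f-μ₁  : ∀ i → f (Inverse.to μ (inj₁ i)) ≡ inj₁ (f₁ i)
    f-μ₂  : ∀ j → f (Inverse.to μ (inj₂ j)) ≡ inj₂ (f₂ j)

sumSplit : ∀ {A B : Set} {m} (f : Fin m → A ⊎ B) → SumSplit f
sumSplit {m = zero} f = record
  { m₁ = 0 ; m₂ = 0
  ; μ = mk↔ₛ′ (λ { (inj₁ ()) ; (inj₂ ()) }) (λ ()) (λ ()) (λ { (inj₁ ()) ; (inj₂ ()) })
  ; f₁ = λ () ; f₂ = λ () ; f-μ₁ = λ () ; f-μ₂ = λ () }
sumSplit {m = suc m} f with f zero in f0 | sumSplit (f ∘ suc)
... | inj₁ a | S = record
  { m₁ = suc m₁ ; m₂ = m₂ ; μ = suc-⊎ˡ-↔ μ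
  ; f₁ = λ { zero → a ; (suc i) → f₁ i } ; f₂ = f₂
  ; f-μ₁ = λ { zero → f0 ; (suc i) → f-μ₁ i } ; f-μ₂ = f-μ₂ }
  where open SumSplit S
... | inj₂ b | S = record
  { m₁ = m₁ ; m₂ = suc m₂ ; μ = suc-⊎ʳ-↔ μ
  ; f₁ = f₁ ; f₂ = λ { zero → b ; (suc j) → f₂ j }
  ; f-μ₁ = f-μ₁ ; f-μ₂ = λ { zero → f0 ; (suc j) → f-μ₂ j } }
  where open SumSplit S

module _ (P : AssocPresheaf) where
  open AssocPresheaf P

  act-comp-pointwise : ∀ {l m n} (f : Fin m ↣ Fin n) (g : Fin l ↣ Fin m) (h : Fin l ↣ Fin n) →
                       (∀ i → to h i ≡ to f (to g i)) → ∀ x → act h x ≡ act g (act f x)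
  act-comp-pointwise f g h h≗f∘g x = trans (act-ext h (f ↣-∘ g) h≗f∘g x) (act-comp f g x)

  act-cast : ∀ {k k′} (eq : k ≡ k′) (y : H k′) → _≡_ {A = Σ ℕ H} (k , act (cast-↣ eq) y) (k′ , y)
  act-cast refl y = cong (_ ,_) (trans (act-ext (cast-↣ refl) (↣-id _) (cast-is-id refl) y) (act-id y))

  Irreducible-resp-≡ : ∀ {k k′} {t : H k} {t′ : H k′} →
                       _≡_ {A = Σ ℕ H} (k , t) (k′ , t′) → Irreducible P t → Irreducible P t′
  Irreducible-resp-≡ refl irr = irr

  IsUnit : ∀ {m} → H m → Set
  IsUnit {m} t = _≡_ {A = Σ ℕ H} (m , t) (unitObj P)

  ∗-unitˡ′ : ∀ {m₁ m₂} {u : H m₁} (v : H m₂) → IsUnit u →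
             _≡_ {A = Σ ℕ H} (m₁ + m₂ , u ∗ v) (m₂ , v)
  ∗-unitˡ′ v refl = ∗-unitˡ v

  slot-injective : ∀ (xs : List (Σ ℕ H)) i {p p′} → slot P xs i p ≡ slot P xs i p′ → p ≡ p′
  slot-injective ((m , _) ∷ xs) zero    eq = ↑ˡ-injective (total P xs) _ _ eq
  slot-injective ((m , _) ∷ xs) (suc i) eq = slot-injective xs i (↑ʳ-injective m _ _ eq)

  slot-disjoint : ∀ (xs : List (Σ ℕ H)) i j {p p′} → slot P xs i p ≡ slot P xs j p′ → i ≡ j
  slot-disjoint (_ ∷ xs)       zero    zero    eq = refl
  slot-disjoint ((m , _) ∷ xs) zero    (suc j) eq = ⊥-elim (↑ˡ≢↑ʳ _ _ eq)
  slot-disjoint ((m , _) ∷ xs) (suc i) zero    eq = ⊥-elim (↑ˡ≢↑ʳ _ _ (sym eq))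
  slot-disjoint ((m , _) ∷ xs) (suc i) (suc j) eq = cong suc (slot-disjoint xs i j (↑ʳ-injective m _ _ eq))

  slot-↣ : ∀ (xs : List (Σ ℕ H)) i → Fin (size P xs i) ↣ Fin (total P xs)
  slot-↣ xs i = mk↣ (slot-injective xs i)

  record RestrictedProduct {p q m} (e : Fin m ↣ Fin (p + q)) (a : H p) (b : H q) : Set where
    field
      m₁ m₂      : ℕ
      e₁         : Fin m₁ ↣ Fin p
      e₂         : Fin m₂ ↣ Fin q
      is-product : IsProduct P (act e (a ∗ b)) (act e₁ a) (act e₂ b)
      located    : ∀ k → (∃[ i ] to e k ≡ to e₁ i ↑ˡ q) ⊎ (∃[ j ] to e k ≡ p ↑ʳ to e₂ j)

    located-left : m₂ ≡ 0 → ∀ k → ∃[ i ] to e k ≡ to e₁ i ↑ˡ q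
    located-left m₂≡0 k with located k
    ... | inj₁ in-left       = in-left
    ... | inj₂ (j , _)       = ⊥-elim (Fin-≡0 m₂≡0 j)

    located-right : m₁ ≡ 0 → ∀ k → ∃[ j ] to e k ≡ p ↑ʳ to e₂ j
    located-right m₁≡0 k with located k
    ... | inj₁ (i , _)       = ⊥-elim (Fin-≡0 m₁≡0 i)
    ... | inj₂ in-right      = in-right

  restrict-∗ : ∀ {p q m} (e : Fin m ↣ Fin (p + q)) (a : H p) (b : H q) → RestrictedProduct e a b
  restrict-∗ {p} {q} {m} e a b = record
    { m₁ = m₁ ; m₂ = m₂ ; e₁ = e₁ ; e₂ = e₂
    ; is-product = τ , trans (sym (act-comp e (↔⇒↣ τ) (a ∗ b))) restricted-∗
    ; located = λ k → locate (Inverse.strictlyInverseˡ μ k) }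
    where
    open SumSplit (sumSplit (splitAt p ∘ to e))
    μ-to : Fin m₁ ⊎ Fin m₂ → Fin m
    μ-to = Inverse.to μ
    e-μ₁ : ∀ i → to e (μ-to (inj₁ i)) ≡ f₁ i ↑ˡ q
    e-μ₁ i = trans (sym (join-splitAt p q _)) (cong (join p q) (f-μ₁ i))
    e-μ₂ : ∀ j → to e (μ-to (inj₂ j)) ≡ p ↑ʳ f₂ j
    e-μ₂ j = trans (sym (join-splitAt p q _)) (cong (join p q) (f-μ₂ j))
    e-μ-injective : ∀ {s s′} → to e (μ-to s) ≡ to e (μ-to s′) → s ≡ s′
    e-μ-injective = injective (↔⇒↣ μ) ∘ injective e
    e₁ : Fin m₁ ↣ Fin p
    e₁ = mk↣ λ {i} {i′} f₁i≡f₁i′ →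
      inj₁-injective (e-μ-injective (trans (e-μ₁ i) (trans (cong (_↑ˡ q) f₁i≡f₁i′) (sym (e-μ₁ i′)))))
    e₂ : Fin m₂ ↣ Fin q
    e₂ = mk↣ λ {j} {j′} f₂j≡f₂j′ →
      inj₂-injective (e-μ-injective (trans (e-μ₂ j) (trans (cong (p ↑ʳ_) f₂j≡f₂j′) (sym (e-μ₂ j′)))))
    τ : Fin (m₁ + m₂) ↔ Fin m
    τ = μ ↔-∘ +↔⊎
    restricted-∗ : act (e ↣-∘ ↔⇒↣ τ) (a ∗ b) ≡ act e₁ a ∗ act e₂ b
    restricted-∗ = ∗-natural e₁ e₂ (e ↣-∘ ↔⇒↣ τ)
      (λ i → trans (cong (to e ∘ μ-to) (splitAt-↑ˡ m₁ i m₂)) (e-μ₁ i))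
      (λ j → trans (cong (to e ∘ μ-to) (splitAt-↑ʳ m₁ m₂ j)) (e-μ₂ j)) a b
    locate : ∀ {k s} → μ-to s ≡ k → (∃[ i ] to e k ≡ f₁ i ↑ˡ q) ⊎ (∃[ j ] to e k ≡ p ↑ʳ f₂ j)
    locate {s = inj₁ i} refl = inj₁ (i , e-μ₁ i)
    locate {s = inj₂ j} refl = inj₂ (j , e-μ₂ j)

module ConnectedPresheaf (P : AssocPresheaf) (connected : Connected P) where
  open AssocPresheaf P

  irreducible-inhabited : ∀ {m} {t : H m} → Irreducible P t → Fin m
  irreducible-inhabited {zero}  {t} (t≢1 , _) = ⊥-elim (t≢1 (cong (0 ,_) (connected t)))
  irreducible-inhabited {suc m} _ = zero

  Irreducible-resp-↔ : ∀ {k m} (τ : Fin k ↔ Fin m) {t : H m} →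
                       Irreducible P t → Irreducible P (act (↔⇒↣ τ) t)
  Irreducible-resp-↔ τ {t} t-irr@(_ , t-atom) = τt≢1 , τt-atom
    where
    τt≢1 : ¬ IsUnit P (act (↔⇒↣ τ) t)
    τt≢1 τt≡1 = Fin-≡0 (,-injectiveˡ τt≡1) (Inverse.from τ (irreducible-inhabited t-irr))
    τt-atom : ∀ {p q} (a : H p) (b : H q) → IsProduct P (act (↔⇒↣ τ) t) a b → IsUnit P a ⊎ IsUnit P b
    τt-atom a b (σ , τσt≡a∗b) = t-atom a b (τ ↔-∘ σ ,
      trans (act-comp-pointwise P (↔⇒↣ τ) (↔⇒↣ σ) (↔⇒↣ (τ ↔-∘ σ)) (λ _ → refl) t) τσt≡a∗b)

  ∗-restrictˡ : ∀ {m n} (a : H m) (b : H n) → act (↑ˡ-↣ m n) (a ∗ b) ≡ a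
  ∗-restrictˡ {m} {n} a b = ,-injectiveʳ-UIP ≡-irrelevant (begin
    (m , y)                                  ≡⟨ act-cast P m+0≡m y ⟨
    (m + 0 , act (cast-↣ m+0≡m) y)           ≡⟨ cong (m + 0 ,_) y-restricts-to-a∗1 ⟩
    (m + 0 , a ∗ one)                        ≡⟨ ∗-unitʳ a ⟩
    (m , a)                                  ∎)
    where
    open ≡-Reasoning
    m+0≡m : m + 0 ≡ m
    m+0≡m = +-identityʳ m
    y : H m
    y = act (↑ˡ-↣ m n) (a ∗ b)
    y-restricts-to-a∗1 : act (cast-↣ m+0≡m) y ≡ a ∗ one
    y-restricts-to-a∗1 = begin
      act (cast-↣ m+0≡m) y                      ≡⟨ act-comp (↑ˡ-↣ m n) (cast-↣ m+0≡m) (a ∗ b) ⟨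
      act (↑ˡ-↣ m n ↣-∘ cast-↣ m+0≡m) (a ∗ b)   ≡⟨ ∗-natural (↣-id _) Fin0-↣ (↑ˡ-↣ m n ↣-∘ cast-↣ m+0≡m) (cong (_↑ˡ n) ∘ cast-↑ˡ0) (λ ()) a b ⟩
      act (↣-id _) a ∗ act Fin0-↣ b             ≡⟨ cong₂ _∗_ (act-id a) (connected _) ⟩
      a ∗ one                                   ∎

  ∗-restrictʳ : ∀ {m n} (a : H m) (b : H n) → act (↑ʳ-↣ m n) (a ∗ b) ≡ b
  ∗-restrictʳ {m} {n} a b = ,-injectiveʳ-UIP ≡-irrelevant (trans (cong (n ,_) y≡1∗b) (∗-unitˡ b))
    where
    y≡1∗b : act (↑ʳ-↣ m n) (a ∗ b) ≡ one ∗ b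
    y≡1∗b = trans (∗-natural Fin0-↣ (↣-id _) (↑ʳ-↣ m n) (λ ()) (λ _ → refl) a b)
                  (cong₂ _∗_ (connected _) (act-id b))

  prod-restrict-slot : ∀ (xs : List (Σ ℕ H)) i → act (slot-↣ P xs i) (prod P xs) ≡ factor P xs i
  prod-restrict-slot ((m , x) ∷ xs) zero =
    trans (act-ext _ (↑ˡ-↣ m (total P xs)) (λ _ → refl) (x ∗ prod P xs)) (∗-restrictˡ x (prod P xs))
  prod-restrict-slot ((m , x) ∷ xs) (suc i) =
    trans (act-comp-pointwise P (↑ʳ-↣ m (total P xs)) (slot-↣ P xs i) _ (λ _ → refl) (x ∗ prod P xs))
          (trans (cong (act (slot-↣ P xs i)) (∗-restrictʳ x (prod P xs))) (prod-restrict-slot xs i))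

  irreducible-within-slot : ∀ (xs : List (Σ ℕ H)) {m} (e : Fin m ↣ Fin (total P xs)) →
                            Irreducible P (act e (prod P xs)) →
                            ∃[ j ] ∀ k → ∃[ p ] to e k ≡ slot P xs j p
  irreducible-within-slot [] e irr with to e (irreducible-inhabited irr)
  ... | ()
  irreducible-within-slot ((a , x) ∷ xs) e irr = within (proj₂ irr _ _ is-product)
    where
    open RestrictedProduct (restrict-∗ P e x (prod P xs))
    within : IsUnit P (act e₁ x) ⊎ IsUnit P (act e₂ (prod P xs)) →
             ∃[ j ] ∀ k → ∃[ p ] to e k ≡ slot P ((a , x) ∷ xs) j p
    within (inj₂ right≡1) = zero , λ k →
      let (i , eₖ≡) = located-left (,-injectiveˡ right≡1) k in to e₁ i , eₖ≡
    within (inj₁ left≡1) with irreducible-within-slot xs e₂ tail-irreducible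
      where
      tail-irreducible : Irreducible P (act e₂ (prod P xs))
      tail-irreducible = Irreducible-resp-≡ P (trans (cong (_ ,_) (proj₂ is-product)) (∗-unitˡ′ P _ left≡1))
                                              (Irreducible-resp-↔ (proj₁ is-product) irr)
    ... | j , e₂-within = suc j , λ k →
      let (l , eₖ≡) = located-right (,-injectiveˡ left≡1) k
          (p , e₂ₗ≡) = e₂-within l
      in p , trans eₖ≡ (cong (a ↑ʳ_) e₂ₗ≡)

  module _ {n : ℕ} {o : H n} where

    block-↣ : (F : Factorization P o) → ∀ i → Fin (size P (factors F) i) ↣ Fin n
    block-↣ F i = ↔⇒↣ (σ F) ↣-∘ slot-↣ P (factors F) i

    o-restrict-block : (F : Factorization P o) → ∀ i → act (block-↣ F i) o ≡ x F i
    o-restrict-block F i = begin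
      act (↔⇒↣ (σ F) ↣-∘ slot-↣ P (factors F) i) o        ≡⟨ act-comp _ _ o ⟩
      act (slot-↣ P (factors F) i) (act (↔⇒↣ (σ F)) o)    ≡⟨ cong (act _) (is-prod F) ⟩
      act (slot-↣ P (factors F) i) (prod P (factors F))   ≡⟨ prod-restrict-slot (factors F) i ⟩
      x F i                                               ∎
      where open ≡-Reasoning

    blocks-disjoint : (F : Factorization P o) → ∀ i j {p p′} → emb F i p ≡ emb F j p′ → i ≡ j
    blocks-disjoint F i j = slot-disjoint P (factors F) i j ∘ injective (↔⇒↣ (σ F))

    Block⊆ : (F : Factorization P o) → Fin (len F) → (G : Factorization P o) → Fin (len G) → Set
    Block⊆ F i G j = ∀ p → ∃[ q ] emb F i p ≡ emb G j q

    irreducible-block⊆ : (F : Factorization P o) → IntoIrreducibles P F →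
                         (G : Factorization P o) → ∀ i → ∃[ j ] Block⊆ F i G j
    irreducible-block⊆ F F-irr G i = proj₁ within , λ p → map₂ σ-shift (proj₂ within p)
      where
      e : Fin (size P (factors F) i) ↣ Fin (total P (factors G))
      e = ↔⇒↣ (↔-sym (σ G)) ↣-∘ block-↣ F i
      e-restricts-to-x : act e (prod P (factors G)) ≡ x F i
      e-restricts-to-x = begin
        act e (prod P (factors G))                  ≡⟨ cong (act e) (is-prod G) ⟨
        act e (act (↔⇒↣ (σ G)) o)                   ≡⟨ act-comp-pointwise P (↔⇒↣ (σ G)) e (block-↣ F i)
                                                         (λ _ → sym (Inverse.strictlyInverseˡ (σ G) _)) o ⟨
        act (block-↣ F i) o                         ≡⟨ o-restrict-block F i ⟩
        x F i                                       ∎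
        where open ≡-Reasoning
      within : ∃[ j ] ∀ p → ∃[ q ] to e p ≡ slot P (factors G) j q
      within = irreducible-within-slot (factors G) e (subst (Irreducible P) (sym e-restricts-to-x) (F-irr i))
      σ-shift : ∀ {p q} → to e p ≡ slot P (factors G) (proj₁ within) q → emb F i p ≡ emb G (proj₁ within) q
      σ-shift {p} eₚ≡ = trans (sym (Inverse.strictlyInverseˡ (σ G) (emb F i p))) (cong (Inverse.to (σ G)) eₚ≡)

    Block⊆-round-trip : (F G : Factorization P o) → IntoIrreducibles P F → ∀ {i j i′} →
                        Block⊆ F i G j → Block⊆ G j F i′ → i′ ≡ i
    Block⊆-round-trip F G F-irr {i} {j} {i′} i⊆j j⊆i′ =
      sym (blocks-disjoint F i i′ (trans (proj₂ (i⊆j p₀)) (proj₂ (j⊆i′ (proj₁ (i⊆j p₀))))))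
      where
      p₀ : Fin (size P (factors F) i)
      p₀ = irreducible-inhabited (F-irr i)

    SameBlock : (F G : Factorization P o) → Fin (len F) → Fin (len G) → Set
    SameBlock F G i j = Block⊆ F i G j × Block⊆ G j F i

    SameBlock⇒SameSubset : (F G : Factorization P o) → ∀ {i j} → SameBlock F G i j →
                            SameSubset P (InBlock F i) (InBlock G j)
    SameBlock⇒SameSubset F G (i⊆j , j⊆i) e = mk⇔
      (λ (p , eₚ≡e) → proj₁ (i⊆j p) , trans (sym (proj₂ (i⊆j p))) eₚ≡e)
      (λ (q , e_q≡e) → proj₁ (j⊆i q) , trans (sym (proj₂ (j⊆i q))) e_q≡e)

    SameBlock⇒SameFactor : (F G : Factorization P o) → ∀ {i j} → SameBlock F G i j →
                            SameFactor P F G i j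
    SameBlock⇒SameFactor F G {i} {j} (i⊆j , j⊆i) = ρ , (λ p → sym (proj₂ (i⊆j p))) , ρ-moves-y-to-x
      where
      ρ : Fin (size P (factors F) i) ↔ Fin (size P (factors G) j)
      ρ = mk↔ₛ′ (proj₁ ∘ i⊆j) (proj₁ ∘ j⊆i)
            (λ q → injective (block-↣ G j) (trans (sym (proj₂ (i⊆j (proj₁ (j⊆i q))))) (sym (proj₂ (j⊆i q)))))
            (λ p → injective (block-↣ F i) (trans (sym (proj₂ (j⊆i (proj₁ (i⊆j p))))) (sym (proj₂ (i⊆j p)))))
      ρ-moves-y-to-x : act (↔⇒↣ ρ) (x G j) ≡ x F i
      ρ-moves-y-to-x = begin
        act (↔⇒↣ ρ) (x G j)                       ≡⟨ cong (act (↔⇒↣ ρ)) (o-restrict-block G j) ⟨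
        act (↔⇒↣ ρ) (act (block-↣ G j) o)         ≡⟨ act-comp-pointwise P (block-↣ G j) (↔⇒↣ ρ) (block-↣ F i)
                                                       (proj₂ ∘ i⊆j) o ⟨
        act (block-↣ F i) o                       ≡⟨ o-restrict-block F i ⟩
        x F i                                     ∎
        where open ≡-Reasoning

    record BlockMatching (F G : Factorization P o) : Set where
      field
        π        : Fin (len F) ↔ Fin (len G)
        matchedˡ : ∀ i → SameBlock F G i (Inverse.to π i)
        matchedʳ : ∀ j → SameBlock F G (Inverse.from π j) j

    block-matching : (F G : Factorization P o) → IntoIrreducibles P F → IntoIrreducibles P G →
                     BlockMatching F G
    block-matching F G F-irr G-irr = record
      { π        = mk↔ₛ′ φ ψ φψ≡id ψφ≡id
      ; matchedˡ = λ i → F⊆G i , subst (Block⊆ G (φ i) F) (ψφ≡id i) (G⊆F (φ i))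
      ; matchedʳ = λ j → subst (Block⊆ F (ψ j) G) (φψ≡id j) (F⊆G (ψ j)) , G⊆F j
      }
      where
      φ : Fin (len F) → Fin (len G)
      φ i = proj₁ (irreducible-block⊆ F F-irr G i)
      F⊆G : ∀ i → Block⊆ F i G (φ i)
      F⊆G i = proj₂ (irreducible-block⊆ F F-irr G i)
      ψ : Fin (len G) → Fin (len F)
      ψ j = proj₁ (irreducible-block⊆ G G-irr F j)
      G⊆F : ∀ j → Block⊆ G j F (ψ j)
      G⊆F j = proj₂ (irreducible-block⊆ G G-irr F j)
      ψφ≡id : ∀ i → ψ (φ i) ≡ i
      ψφ≡id i = Block⊆-round-trip F G F-irr (F⊆G i) (G⊆F (φ i))
      φψ≡id : ∀ j → φ (ψ j) ≡ j
      φψ≡id j = Block⊆-round-trip G F G-irr (G⊆F j) (F⊆G (ψ j))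

open ConnectedPresheaf using (module BlockMatching; block-matching; SameBlock⇒SameSubset; SameBlock⇒SameFactor)

mainTheorem8 : (P : AssocPresheaf) → Connected P →
    ∀ {n : ℕ} (o : AssocPresheaf.H P n) (F G : Factorization P o) →
    IntoIrreducibles P F → IntoIrreducibles P G →
    SamePartition P F G × (len F ≡ len G) × SameFactorMultiset P F G
mainTheorem8 P connected o F G F-irr G-irr =
  ( (λ i → Inverse.to π i , SameBlock⇒SameSubset P connected F G (matchedˡ i))
  , (λ j → Inverse.from π j , SameBlock⇒SameSubset P connected F G (matchedʳ j)) )
  , ↔⇒≡ π
  , (π , λ i → SameBlock⇒SameFactor P connected F G (matchedˡ i))
  where
  open BlockMatching (block-matching P connected F G F-irr G-irr)
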